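{- Let $p$ be a prime, $r\in\mathbb{N}$, $k\in[1,p-1]$, $n=(k+1)p^r-1$, and $d\in[0,n]$. Then for any $E\subseteq[0,n]$, over $\mathbb{F}_p$: $n\in\operatorname{Z\text{ - }cl}_{n,d}(E)$ if and only if $n\in\operatorname{Sym\text{ - }cl}_{n,d}(E)$.
   Context: For integers $a\le b$, $[a,b]$ denotes the set of integers between $a$ and $b$. Work over $\mathbb{F}_p$ with $\{0,1\}^n\subseteq\mathbb{F}_p^n$; $|x|$ is the Hamming weight, and for $E\subseteq[0,n]$, $\underline{E}=\{x\in\{0,1\}^n:|x|\in E\}$. $\operatorname{Z\text{ - }cl}_{n,d}(\underline{E})$ (resp. $\operatorname{Sym\text{ - }cl}_{n,d}(\underline{E})$) is the set of $y\in\{0,1\}^n$ at which every polynomial (resp. every symmetric polynomial) in $\mathbb{F}_p[X_1,\dots,X_n]$ of degree at most $d$ vanishing on $\underline{E}$ also vanishes. Both are symmetric sets, identified with their sets of Hamming weights in $[0,n]$, denoted $\operatorname{Z\text{ - }cl}_{n,d}(E)$ and $\operatorname{Sym\text{ - }cl}_{n,d}(E)$. -}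

module Defs where

open import Data.Nat using (ℕ; zero; suc; _+_; _*_; _∸_; _^_; _≤_)
open import Data.Nat.Divisibility using (_∣_)
open import Data.Nat.Properties using () renaming (_≟_ to _≟ℕ_)
open import Data.Bool using (Bool; true; false; if_then_else_)
open import Data.Fin using (Fin; toℕ)
open import Data.Fin.Subset using (Subset; _∈_)
open import Data.Fin.Permutation using (Permutation′; _⟨$⟩ʳ_)
open import Data.Vec as V using (Vec; tabulate; lookup; replicate; zipWith)
open import Data.Vec.Properties using (≡-dec)
open import Data.List as L using (List)
import Data.Nat.ListAction as LA
open import Data.List.Relation.Unary.All using (All)
open import Data.Product using (_×_; _,_; proj₁; proj₂; ∃)
open import Relation.Nullary using (does)
open import Relation.Binary.PropositionalEquality using (_≡_)

-- Elements of F_p are represented by natural numbers; arithmetic is done in ℕ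
-- and compared modulo p (reduction ℕ → F_p is a ring homomorphism).
_≡_[mod_] : ℕ → ℕ → ℕ → Set
a ≡ b [mod p ] = (p ∣ (a ∸ b)) × (p ∣ (b ∸ a))

Mono : ℕ → Set
Mono n = Vec ℕ n

Poly : ℕ → Set
Poly n = List (ℕ × Mono n)

monoDeg : ∀ {n} → Mono n → ℕ
monoDeg α = V.sum α

DegAtMost : ∀ {n} → ℕ → Poly n → Set
DegAtMost d P = All (λ t → monoDeg (proj₂ t) ≤ d) P

Point : ℕ → Set
Point n = Vec Bool n

b2n : Bool → ℕ
b2n true = 1
b2n false = 0

evalMono : ∀ {n} → Mono n → Point n → ℕ
evalMono α x = LA.product (V.toList (zipWith (λ e b → b2n b ^ e) α x))

eval : ∀ {n} → Poly n → Point n → ℕ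
eval P x = LA.sum (L.map (λ t → proj₁ t * evalMono (proj₂ t) x) P)

VanishesAt : ℕ → ∀ {n} → Poly n → Point n → Set
VanishesAt p P x = p ∣ eval P x

weight : ∀ {n} → Point n → ℕ
weight x = V.sum (V.map b2n x)

coeff : ∀ {n} → Poly n → Mono n → ℕ
coeff P β = LA.sum (L.map (λ t → if does (≡-dec _≟ℕ_ (proj₂ t) β) then proj₁ t else 0) P)

permMono : ∀ {n} → Permutation′ n → Mono n → Mono n
permMono σ β = tabulate (λ i → lookup β (σ ⟨$⟩ʳ i))

Symmetric : ℕ → ∀ {n} → Poly n → Set
Symmetric p {n} P = ∀ (σ : Permutation′ n) (β : Mono n) → coeff P (permMono σ β) ≡ coeff P β [mod p ]

InE : ∀ {n} → Subset (suc n) → ℕ → Set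
InE {n} E w = ∃ λ (i : Fin (suc n)) → (toℕ i ≡ w) × (i ∈ E)

VanishesOn : ℕ → ∀ {n} → Subset (suc n) → Poly n → Set
VanishesOn p {n} E P = ∀ (x : Point n) → InE E (weight x) → VanishesAt p P x

InZclPt : ℕ → (n d : ℕ) → Subset (suc n) → Point n → Set
InZclPt p n d E y = ∀ (P : Poly n) → DegAtMost d P → VanishesOn p E P → VanishesAt p P y

InSymclPt : ℕ → (n d : ℕ) → Subset (suc n) → Point n → Set
InSymclPt p n d E y = ∀ (P : Poly n) → Symmetric p P → DegAtMost d P → VanishesOn p E P → VanishesAt p P y

-- weight-level versions: w ∈ Z-cl_{n,d}(E) (the closures are symmetric sets)
InZcl : ℕ → (n d : ℕ) → Subset (suc n) → ℕ → Set
InZcl p n d E w = ∀ (y : Point n) → weight y ≡ w → InZclPt p n d E y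

InSymcl : ℕ → (n d : ℕ) → Subset (suc n) → ℕ → Set
InSymcl p n d E w = ∀ (y : Point n) → weight y ≡ w → InSymclPt p n d E y

-- Let P have degree ≤ d and vanish on E̲. Replace each term c·X^α of P by c·m_s·e_s, where
-- e_s is the elementary symmetric polynomial of degree s = |supp α| and m_s·C(n,s) = D for a
-- single D prime to p; such multipliers exist because, for n + 1 = (k+1)p^r, the numbers w + 1
-- and n − w have the same p-adic valuation, so C(n,w+1)(w+1) = C(n,w)(n−w) shows inductively
-- that p divides no C(n,w). The new polynomial Q is symmetric of degree ≤ d. At the all-ones
-- point Q = D·P, and at a point x of weight w the identity C(n,w)·C(w,s) = C(n,s)·#{y ⊇ supp α :
-- |y| = w} gives C(n,w)·Q(x) = D·Σ_{|y|=w} P(y), so Q vanishes on E̲ too. Hence n ∈ Sym-cl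
-- forces P(1,…,1) = 0.
module Submission where

open import Defs
open import Data.Bool using (Bool; true; false; _∧_; if_then_else_; T)
open import Data.Fin using (zero; suc)
open import Data.Fin.Permutation using (Permutation′; _⟨$⟩ʳ_; _⟨$⟩ˡ_; inverseʳ)
open import Data.Fin.Subset using (Subset)
open import Data.List as List using ([]; _∷_; _++_)
open import Data.List.Properties using (map-++)
open import Data.List.Relation.Unary.All as All using (All; []; _∷_)
open import Data.List.Relation.Unary.All.Properties using (++⁺; map⁺)
open import Data.Nat
open import Data.Nat.Combinatorics using (_C_; nCk≡n!/k![n-k]!; k![n∸k]!∣n!; k>n⇒nCk≡0; nCk+nC[k+1]≡[n+1]C[k+1])
open import Data.Nat.DivMod using (m/n*n≡m)
open import Data.Nat.Divisibility
open import Data.Nat.Induction using (<-wellFounded)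
import Data.Nat.ListAction as ℕ
open import Data.Nat.ListAction.Properties using (sum-++)
open import Data.Nat.Primality using (Prime; euclidsLemma; prime⇒nonTrivial)
open import Data.Nat.Properties
open import Data.Nat.Tactic.RingSolver using (solve-∀)
open import Data.Product using (_×_; _,_; ∃₂; proj₂; map₁; map₂)
open import Data.Sum using ([_,_]′)
open import Data.Unit using (tt)
open import Data.Vec as Vec using (Vec; []; _∷_; lookup)
open import Data.Vec.Properties using (≡-dec; lookup∘tabulate)
open import Function using (id; _∘_; _∘′_)
open import Function.Bundles using (_⇔_; mk⇔; Equivalence)
open import Function.Construct.Composition using (_⇔-∘_)
open import Function.Construct.Symmetry using (⇔-sym)
open import Induction.WellFounded using (Acc; acc)
open import Relation.Binary.PropositionalEquality
open import Relation.Nullary using (¬_; yes; no; does; contradiction)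
open import Algebra.Properties.CommutativeSemigroup *-commutativeSemigroup using (xy∙z≈xz∙y)
open import Algebra.Properties.CommutativeSemigroup +-commutativeSemigroup using () renaming (interchange to +-interchange)
import Algebra.Properties.CommutativeMonoid.Sum +-0-commutativeMonoid as Σ

private
  variable
    n : ℕ

-- Binomial coefficients

binomial-factorials : ∀ a b → ((a + b) C a) * (a ! * b !) ≡ (a + b) !
binomial-factorials a b = begin
  ((a + b) C a) * (a ! * b !)                              ≡⟨ cong (λ m → ((a + b) C a) * (a ! * m !)) (sym (m+n∸m≡n a b)) ⟩
  ((a + b) C a) * (a ! * (a + b ∸ a) !)                    ≡⟨ cong (_* (a ! * (a + b ∸ a) !)) (nCk≡n!/k![n-k]! a≤a+b) ⟩
  (a + b) ! / (a ! * (a + b ∸ a) !) * (a ! * (a + b ∸ a) !) ≡⟨ m/n*n≡m (k![n∸k]!∣n! a≤a+b) ⟩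
  (a + b) !                                                ∎
  where
  open ≡-Reasoning
  a≤a+b : a ≤ a + b
  a≤a+b = m≤m+n a b
  instance
    factorials≢0 : NonZero (a ! * (a + b ∸ a) !)
    factorials≢0 = a !* (a + b ∸ a) !≢0

binomial-absorption : ∀ w u → (suc (w + u) C suc w) * suc w ≡ (suc (w + u) C w) * suc u
binomial-absorption w u = *-cancelʳ-≡ _ _ (w ! * u !) {{w !* u !≢0}} (begin
  (suc (w + u) C suc w) * suc w * (w ! * u !)   ≡⟨ regroup₁ (suc (w + u) C suc w) w (w !) (u !) ⟩
  ((suc w + u) C suc w) * (suc w ! * u !)       ≡⟨ binomial-factorials (suc w) u ⟩
  (suc w + u) !                                 ≡⟨ cong _! (sym (+-suc w u)) ⟩
  (w + suc u) !                                 ≡⟨ sym (binomial-factorials w (suc u)) ⟩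
  ((w + suc u) C w) * (w ! * suc u !)           ≡⟨ cong (λ m → (m C w) * (w ! * suc u !)) (+-suc w u) ⟩
  (suc (w + u) C w) * (w ! * suc u !)           ≡⟨ regroup₂ (suc (w + u) C w) u (w !) (u !) ⟩
  (suc (w + u) C w) * suc u * (w ! * u !)       ∎)
  where
  open ≡-Reasoning
  regroup₁ : ∀ c w x y → c * suc w * (x * y) ≡ c * ((suc w * x) * y)
  regroup₁ = solve-∀
  regroup₂ : ∀ c u x y → c * (x * (suc u * y)) ≡ c * suc u * (x * y)
  regroup₂ = solve-∀

binomial-subsetOfSubset : ∀ s m t → ((s + m) C (s + t)) * ((s + t) C s) ≡ ((s + m) C s) * (m C t)
binomial-subsetOfSubset s m t with t ≤? m
... | yes t≤m = subst (λ m → ((s + m) C (s + t)) * ((s + t) C s) ≡ ((s + m) C s) * (m C t))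
                      (m+[n∸m]≡n t≤m) (splitAt (m ∸ t))
  where
  open ≡-Reasoning
  regroup₁ : ∀ a b x y z → a * b * (x * y * z) ≡ a * (b * (x * y) * z)
  regroup₁ = solve-∀
  regroup₂ : ∀ a b x y z → a * (x * (b * (y * z))) ≡ a * b * (x * y * z)
  regroup₂ = solve-∀
  splitAt : ∀ u → ((s + (t + u)) C (s + t)) * ((s + t) C s) ≡ ((s + (t + u)) C s) * ((t + u) C t)
  splitAt u = *-cancelʳ-≡ _ _ (s ! * t ! * u !) {{m*n≢0 _ _ {{s !* t !≢0}} {{u !≢0}}}} (begin
    ((s + (t + u)) C (s + t)) * ((s + t) C s) * (s ! * t ! * u !)
      ≡⟨ regroup₁ ((s + (t + u)) C (s + t)) ((s + t) C s) (s !) (t !) (u !) ⟩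
    ((s + (t + u)) C (s + t)) * (((s + t) C s) * (s ! * t !) * u !)
      ≡⟨ cong (λ x → ((s + (t + u)) C (s + t)) * (x * u !)) (binomial-factorials s t) ⟩
    ((s + (t + u)) C (s + t)) * ((s + t) ! * u !)
      ≡⟨ subst (λ m → (m C (s + t)) * ((s + t) ! * u !) ≡ m !) (+-assoc s t u) (binomial-factorials (s + t) u) ⟩
    (s + (t + u)) !
      ≡⟨ sym (binomial-factorials s (t + u)) ⟩
    ((s + (t + u)) C s) * (s ! * (t + u) !)
      ≡⟨ cong (λ x → ((s + (t + u)) C s) * (s ! * x)) (sym (binomial-factorials t u)) ⟩
    ((s + (t + u)) C s) * (s ! * (((t + u) C t) * (t ! * u !)))
      ≡⟨ regroup₂ ((s + (t + u)) C s) ((t + u) C t) (s !) (t !) (u !) ⟩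
    ((s + (t + u)) C s) * ((t + u) C t) * (s ! * t ! * u !) ∎)
... | no t≰m = begin
  ((s + m) C (s + t)) * ((s + t) C s) ≡⟨ cong (_* ((s + t) C s)) (k>n⇒nCk≡0 (+-monoʳ-< s m<t)) ⟩
  0                                   ≡⟨ sym (*-zeroʳ ((s + m) C s)) ⟩
  ((s + m) C s) * 0                   ≡⟨ cong (((s + m) C s) *_) (sym (k>n⇒nCk≡0 m<t)) ⟩
  ((s + m) C s) * (m C t)             ∎
  where
  open ≡-Reasoning
  m<t : m < t
  m<t = ≰⇒> t≰m

-- Divisibility by a prime

EqualValuation : ℕ → ℕ → ℕ → Set
EqualValuation p x y = ∀ j → p ^ j ∣ x ⇔ p ^ j ∣ y

^-mono-∣ : ∀ p {j r} → j ≤ r → p ^ j ∣ p ^ r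
^-mono-∣ p {j} {r} j≤r =
  subst (p ^ j ∣_) (trans (sym (^-distribˡ-+-* p j (r ∸ j))) (cong (p ^_) (m+[n∸m]≡n j≤r))) (m∣m*n (p ^ (r ∸ j)))

module _ {p : ℕ} (p-prime : Prime p) where

  private instance
    p-nonTrivial : NonTrivial p
    p-nonTrivial = prime⇒nonTrivial p-prime
    p-nonZero : NonZero p
    p-nonZero = nonTrivial⇒nonZero p

  private
    ∣⇔^1∣ : ∀ {x} → p ∣ x ⇔ p ^ 1 ∣ x
    ∣⇔^1∣ {x} = mk⇔ (subst (_∣ x) (sym (*-identityʳ p))) (subst (_∣ x) (*-identityʳ p))

    ^suc∣*p⇔^∣ : ∀ j x → p ^ suc j ∣ x * p ⇔ p ^ j ∣ x
    ^suc∣*p⇔^∣ j x = mk⇔ (λ h → *-cancelʳ-∣ p (subst (_∣ x * p) (*-comm p (p ^ j)) h))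
                         (λ h → subst (_∣ x * p) (*-comm (p ^ j) p) (*-monoˡ-∣ p h))

  ∤-∣*⇒∣ : ∀ {a b} → ¬ p ∣ a → p ∣ a * b → p ∣ b
  ∤-∣*⇒∣ {a} {b} p∤a p∣ab = [ (λ p∣a → contradiction p∣a p∤a) , id ]′ (euclidsLemma a b p-prime p∣ab)

  equalValuation⇒∣⇔∣ : ∀ {x y} → EqualValuation p x y → p ∣ x ⇔ p ∣ y
  equalValuation⇒∣⇔∣ x≈y = ⇔-sym ∣⇔^1∣ ⇔-∘ (x≈y 1 ⇔-∘ ∣⇔^1∣)

  -- Strip common factors p from x and y until p ∤ x; then Euclid's lemma applies.
  ∣-transfer : ∀ {a b x y} → 0 < x → EqualValuation p x y → a * x ≡ b * y → p ∣ a → p ∣ b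
  ∣-transfer {x = x} = go (<-wellFounded x)
    where
    go : ∀ {a b x y} → Acc _<_ x → 0 < x → EqualValuation p x y → a * x ≡ b * y → p ∣ a → p ∣ b
    go {a} {b} {x} {y} (acc rec) 0<x x≈y ax≡by p∣a with p ∣? x
    ... | no p∤x = ∤-∣*⇒∣ p∤y (subst (p ∣_) (trans ax≡by (*-comm b y)) (∣-trans p∣a (m∣m*n x)))
      where
      p∤y : ¬ p ∣ y
      p∤y = p∤x ∘ Equivalence.from (equalValuation⇒∣⇔∣ x≈y)
    ... | yes p∣x@(divides x′ refl) with Equivalence.to (equalValuation⇒∣⇔∣ x≈y) p∣x
    ...   | divides y′ refl = go (rec x′<x) 0<x′ x′≈y′ ax′≡by′ p∣a
      where
      positive : ∀ {m} → 0 < m * p → 0 < m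
      positive {suc _} _ = z<s
      0<x′ : 0 < x′
      0<x′ = positive 0<x
      x′<x : x′ < x′ * p
      x′<x = m<m*n x′ p {{>-nonZero 0<x′}} (nonTrivial⇒n>1 p)
      x′≈y′ : EqualValuation p x′ y′
      x′≈y′ j = ^suc∣*p⇔^∣ j y′ ⇔-∘ (x≈y (suc j) ⇔-∘ ⇔-sym (^suc∣*p⇔^∣ j x′))
      ax′≡by′ : a * x′ ≡ b * y′
      ax′≡by′ = *-cancelʳ-≡ _ _ p (trans (*-assoc a x′ p) (trans ax≡by (sym (*-assoc b y′ p))))

  module _ {r N : ℕ} (p^r∣N : p ^ r ∣ N) (N≤p^[1+r] : N ≤ p ^ suc r) where

    ^∣-complement : ∀ {i} j → 0 < i → i < N → p ^ j ∣ i → p ^ j ∣ N ∸ i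
    ^∣-complement {i} j 0<i i<N p^j∣i with j ≤? r
    ... | yes j≤r = ∣m+n∣m⇒∣n (subst (p ^ j ∣_) (sym (m+[n∸m]≡n (<⇒≤ i<N))) (∣-trans (^-mono-∣ p j≤r) p^r∣N)) p^j∣i
    ... | no j≰r = contradiction (begin-strict
      p ^ suc r ≤⟨ ^-monoʳ-≤ p (≰⇒> j≰r) ⟩
      p ^ j     ≤⟨ ∣⇒≤ {{>-nonZero 0<i}} p^j∣i ⟩
      i         <⟨ i<N ⟩
      N         ≤⟨ N≤p^[1+r] ⟩
      p ^ suc r ∎) (<-irrefl refl)
      where open ≤-Reasoning

    equalValuation-complement : ∀ {i} → 0 < i → i < N → EqualValuation p i (N ∸ i)
    equalValuation-complement {i} 0<i i<N j = mk⇔ (^∣-complement j 0<i i<N)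
      (λ h → subst (p ^ j ∣_) (m∸[m∸n]≡n (<⇒≤ i<N))
                   (^∣-complement j (m<n⇒0<n∸m i<N) (∸-monoʳ-< 0<i (<⇒≤ i<N)) h))

  prime∤binomial : ∀ {r n} → p ^ r ∣ suc n → suc n ≤ p ^ suc r → ∀ {w} → w ≤ n → ¬ p ∣ n C w
  prime∤binomial _ _ {zero} _ p∣1 = nonTrivial⇒≢1 (∣1⇒≡1 p∣1)
  prime∤binomial {r} {n} p^r∣N N≤p^[1+r] {suc w} w<n with m≤n⇒∃[o]m+o≡n w<n
  ... | u , refl = prime∤binomial {r} p^r∣N N≤p^[1+r] (m≤n⇒m≤1+n (m≤m+n w u)) ∘′
                   ∣-transfer z<s [1+w]≈[1+u] (binomial-absorption w u)
    where
    [1+w]≈[1+u] : EqualValuation p (suc w) (suc u)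
    [1+w]≈[1+u] = subst (EqualValuation p (suc w)) (trans (cong (_∸ w) (sym (+-suc w u))) (m+n∸m≡n w (suc u)))
                        (equalValuation-complement {r} p^r∣N N≤p^[1+r] z<s (s≤s w<n))

  ∤-commonMultiple : ∀ (f : ℕ → ℕ) N → (∀ {t} → t < N → ¬ p ∣ f t) →
                     ∃₂ λ D (m : ℕ → ℕ) → ¬ p ∣ D × (∀ {s} → s < N → m s * f s ≡ D)
  ∤-commonMultiple f zero _ = 1 , (λ _ → 1) , (λ p∣1 → nonTrivial⇒≢1 (∣1⇒≡1 p∣1)) , λ ()
  ∤-commonMultiple f (suc N) p∤f with ∤-commonMultiple f N (p∤f ∘′ m<n⇒m<1+n)
  ... | D , m , p∤D , m*f≡D = D * f N , m′ , p∤D*fN , m′*f≡D*fN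
    where
    m′ : ℕ → ℕ
    m′ s with s <? N
    ... | yes _ = m s * f N
    ... | no _ = D
    p∤D*fN : ¬ p ∣ D * f N
    p∤D*fN = p∤f ≤-refl ∘ ∤-∣*⇒∣ p∤D
    m′*f≡D*fN : ∀ {s} → s < suc N → m′ s * f s ≡ D * f N
    m′*f≡D*fN {s} s≤N with s <? N
    ... | yes s<N = trans (xy∙z≈xz∙y (m s) (f N) (f s)) (cong (_* f N) (m*f≡D s<N))
    ... | no s≮N rewrite ≤-antisym (s≤s⁻¹ s≤N) (≮⇒≥ s≮N) = refl

-- Polynomials on the Boolean cube

scale : ℕ → Poly n → Poly n
scale k = List.map (map₁ (k *_))

prepend : ℕ → Poly n → Poly (suc n)
prepend e = List.map (map₂ (e ∷_))

eval-++ : (A B : Poly n) (x : Point n) → eval (A ++ B) x ≡ eval A x + eval B x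
eval-++ {n} A B x = trans (cong ℕ.sum (map-++ term A B)) (sum-++ (List.map term A) _)
  where
  term : ℕ × Mono n → ℕ
  term (c , α) = c * evalMono α x

eval-scale : ∀ k (A : Poly n) x → eval (scale k A) x ≡ k * eval A x
eval-scale k [] x = sym (*-zeroʳ k)
eval-scale k ((c , α) ∷ A) x = begin
  k * c * evalMono α x + eval (scale k A) x  ≡⟨ cong (k * c * evalMono α x +_) (eval-scale k A x) ⟩
  k * c * evalMono α x + k * eval A x        ≡⟨ distrib k c (evalMono α x) (eval A x) ⟩
  k * (c * evalMono α x + eval A x)          ∎
  where
  open ≡-Reasoning
  distrib : ∀ k c m e → k * c * m + k * e ≡ k * (c * m + e)
  distrib = solve-∀

eval-prepend : ∀ e (A : Poly n) b x → eval (prepend e A) (b ∷ x) ≡ b2n b ^ e * eval A x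
eval-prepend e [] b x = sym (*-zeroʳ (b2n b ^ e))
eval-prepend e ((c , α) ∷ A) b x = begin
  c * (b2n b ^ e * evalMono α x) + eval (prepend e A) (b ∷ x)  ≡⟨ cong (c * (b2n b ^ e * evalMono α x) +_) (eval-prepend e A b x) ⟩
  c * (b2n b ^ e * evalMono α x) + b2n b ^ e * eval A x        ≡⟨ distrib c (b2n b ^ e) (evalMono α x) (eval A x) ⟩
  b2n b ^ e * (c * evalMono α x + eval A x)                    ∎
  where
  open ≡-Reasoning
  distrib : ∀ c B m e → c * (B * m) + B * e ≡ B * (c * m + e)
  distrib = solve-∀

coeff-++ : (A B : Poly n) (β : Mono n) → coeff (A ++ B) β ≡ coeff A β + coeff B β
coeff-++ {n} A B β = trans (cong ℕ.sum (map-++ term A B)) (sum-++ (List.map term A) _)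
  where
  term : ℕ × Mono n → ℕ
  term (c , α) = if does (≡-dec _≟_ α β) then c else 0

coeff-scale : ∀ k (A : Poly n) β → coeff (scale k A) β ≡ k * coeff A β
coeff-scale k [] β = sym (*-zeroʳ k)
coeff-scale k ((c , α) ∷ A) β =
  trans (cong₂ _+_ (if-* (does (≡-dec _≟_ α β))) (coeff-scale k A β)) (sym (*-distribˡ-+ k _ (coeff A β)))
  where
  if-* : ∀ b → (if b then k * c else 0) ≡ k * (if b then c else 0)
  if-* true = refl
  if-* false = sym (*-zeroʳ k)

coeff-prepend : ∀ e (A : Poly n) b β → coeff (prepend e A) (b ∷ β) ≡ (if e ≡ᵇ b then coeff A β else 0)
coeff-prepend e A b β with e ≡ᵇ b in e≡ᵇb
... | true = matching A
  where
  matching : ∀ A → coeff (prepend e A) (b ∷ β) ≡ coeff A β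
  matching [] = refl
  matching ((c , α) ∷ A) rewrite e≡ᵇb = cong (_ +_) (matching A)
... | false = mismatching A
  where
  mismatching : ∀ A → coeff (prepend e A) (b ∷ β) ≡ 0
  mismatching [] = refl
  mismatching ((c , α) ∷ A) rewrite e≡ᵇb = mismatching A

support : Mono n → Point n
support [] = []
support (zero ∷ α) = false ∷ support α
support (suc _ ∷ α) = true ∷ support α

infix 4 _⊆ᵇ_
_⊆ᵇ_ : Point n → Point n → Bool
[] ⊆ᵇ [] = true
(true ∷ S) ⊆ᵇ (b ∷ y) = b ∧ (S ⊆ᵇ y)
(false ∷ S) ⊆ᵇ (_ ∷ y) = S ⊆ᵇ y

coweight : Point n → ℕ
coweight [] = 0
coweight (true ∷ S) = coweight S
coweight (false ∷ S) = suc (coweight S)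

weight+coweight : (S : Point n) → weight S + coweight S ≡ n
weight+coweight [] = refl
weight+coweight (true ∷ S) = cong suc (weight+coweight S)
weight+coweight (false ∷ S) = trans (+-suc (weight S) (coweight S)) (cong suc (weight+coweight S))

weight≤ : (S : Point n) → weight S ≤ n
weight≤ S = subst (weight S ≤_) (weight+coweight S) (m≤m+n (weight S) (coweight S))

weight-support≤monoDeg : (α : Mono n) → weight (support α) ≤ monoDeg α
weight-support≤monoDeg [] = z≤n
weight-support≤monoDeg (zero ∷ α) = weight-support≤monoDeg α
weight-support≤monoDeg (suc e ∷ α) = s≤s (≤-trans (weight-support≤monoDeg α) (m≤n+m _ e))

evalMono-support : (α : Mono n) (y : Point n) → evalMono α y ≡ b2n (support α ⊆ᵇ y)
evalMono-support [] [] = refl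
evalMono-support (zero ∷ α) (b ∷ y) = trans (*-identityˡ _) (evalMono-support α y)
evalMono-support (suc e ∷ α) (true ∷ y) =
  trans (cong (_* evalMono α y) (^-zeroˡ (suc e))) (trans (*-identityˡ _) (evalMono-support α y))
evalMono-support (suc e ∷ α) (false ∷ y) = refl

evalMono-full : (α : Mono n) (y : Point n) → weight y ≡ n → evalMono α y ≡ 1
evalMono-full [] [] _ = refl
evalMono-full (e ∷ α) (true ∷ y) wy≡n = cong₂ _*_ (^-zeroˡ e) (evalMono-full α y (suc-injective wy≡n))
evalMono-full {suc n} (e ∷ α) (false ∷ y) wy≡1+n = contradiction (subst (_≤ n) wy≡1+n (weight≤ y)) (<-irrefl refl)

elementary : (n s : ℕ) → Poly n
elementary zero zero = (1 , []) ∷ []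
elementary zero (suc s) = []
elementary (suc n) zero = prepend 0 (elementary n zero)
elementary (suc n) (suc s) = prepend 1 (elementary n s) ++ prepend 0 (elementary n (suc s))

eval-elementary : ∀ n s (x : Point n) → eval (elementary n s) x ≡ weight x C s
eval-elementary zero zero [] = refl
eval-elementary zero (suc s) [] = refl
eval-elementary (suc n) zero (b ∷ x) =
  trans (eval-prepend 0 (elementary n zero) b x) (trans (*-identityˡ _) (eval-elementary n zero x))
eval-elementary (suc n) (suc s) (b ∷ x) = begin
  eval (prepend 1 (elementary n s) ++ prepend 0 (elementary n (suc s))) (b ∷ x)
    ≡⟨ eval-++ (prepend 1 (elementary n s)) _ (b ∷ x) ⟩
  eval (prepend 1 (elementary n s)) (b ∷ x) + eval (prepend 0 (elementary n (suc s))) (b ∷ x)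
    ≡⟨ cong₂ _+_ (eval-prepend 1 (elementary n s) b x) (eval-prepend 0 (elementary n (suc s)) b x) ⟩
  b2n b ^ 1 * eval (elementary n s) x + 1 * eval (elementary n (suc s)) x
    ≡⟨ cong₂ (λ u v → b2n b ^ 1 * u + 1 * v) (eval-elementary n s x) (eval-elementary n (suc s) x) ⟩
  b2n b ^ 1 * (weight x C s) + 1 * (weight x C suc s)
    ≡⟨ pascal b ⟩
  weight (b ∷ x) C suc s ∎
  where
  open ≡-Reasoning
  pascal : ∀ b → b2n b ^ 1 * (weight x C s) + 1 * (weight x C suc s) ≡ weight (b ∷ x) C suc s
  pascal true = trans (cong₂ _+_ (*-identityˡ (weight x C s)) (*-identityˡ (weight x C suc s))) (nCk+nC[k+1]≡[n+1]C[k+1] (weight x) s)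
  pascal false = *-identityˡ (weight x C suc s)

monoDeg-elementary : ∀ n s → All (λ t → monoDeg (proj₂ t) ≡ s) (elementary n s)
monoDeg-elementary zero zero = refl ∷ []
monoDeg-elementary zero (suc s) = []
monoDeg-elementary (suc n) zero = map⁺ (monoDeg-elementary n zero)
monoDeg-elementary (suc n) (suc s) =
  ++⁺ (map⁺ (All.map (cong suc) (monoDeg-elementary n s))) (map⁺ (monoDeg-elementary n (suc s)))

degAtMost-elementary : ∀ {d} n s → s ≤ d → DegAtMost d (elementary n s)
degAtMost-elementary n s s≤d = All.map (λ deg≡s → subst (_≤ _) (sym deg≡s) s≤d) (monoDeg-elementary n s)

-- The clauses split on β first, so that isSquarefreeOfDegree s (0 ∷ β) reduces for a variable s.
isSquarefreeOfDegree : ℕ → Mono n → Bool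
isSquarefreeOfDegree s (0 ∷ β) = isSquarefreeOfDegree s β
isSquarefreeOfDegree s (suc (suc _) ∷ β) = false
isSquarefreeOfDegree zero (1 ∷ β) = false
isSquarefreeOfDegree (suc s) (1 ∷ β) = isSquarefreeOfDegree s β
isSquarefreeOfDegree zero [] = true
isSquarefreeOfDegree (suc s) [] = false

coeff-elementary : ∀ n s β → coeff (elementary n s) β ≡ b2n (isSquarefreeOfDegree s β)
coeff-elementary zero zero [] = refl
coeff-elementary zero (suc s) [] = refl
coeff-elementary (suc n) zero (b ∷ β) = trans (coeff-prepend 0 (elementary n zero) b β) (headCase b)
  where
  headCase : ∀ b → (if 0 ≡ᵇ b then coeff (elementary n zero) β else 0) ≡ b2n (isSquarefreeOfDegree zero (b ∷ β))
  headCase zero = coeff-elementary n zero β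
  headCase (suc zero) = refl
  headCase (suc (suc _)) = refl
coeff-elementary (suc n) (suc s) (b ∷ β) = begin
  coeff (prepend 1 (elementary n s) ++ prepend 0 (elementary n (suc s))) (b ∷ β)
    ≡⟨ coeff-++ (prepend 1 (elementary n s)) _ (b ∷ β) ⟩
  coeff (prepend 1 (elementary n s)) (b ∷ β) + coeff (prepend 0 (elementary n (suc s))) (b ∷ β)
    ≡⟨ cong₂ _+_ (coeff-prepend 1 (elementary n s) b β) (coeff-prepend 0 (elementary n (suc s)) b β) ⟩
  (if 1 ≡ᵇ b then coeff (elementary n s) β else 0) + (if 0 ≡ᵇ b then coeff (elementary n (suc s)) β else 0)
    ≡⟨ headCase b ⟩
  b2n (isSquarefreeOfDegree (suc s) (b ∷ β)) ∎
  where
  open ≡-Reasoning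
  headCase : ∀ b → (if 1 ≡ᵇ b then coeff (elementary n s) β else 0) + (if 0 ≡ᵇ b then coeff (elementary n (suc s)) β else 0)
                ≡ b2n (isSquarefreeOfDegree (suc s) (b ∷ β))
  headCase zero = coeff-elementary n (suc s) β
  headCase (suc zero) = trans (+-identityʳ _) (coeff-elementary n s β)
  headCase (suc (suc _)) = refl

isSquarefreeOfDegree⇒sum : ∀ s (β : Mono n) → isSquarefreeOfDegree s β ≡ true → Vec.sum β ≡ s
isSquarefreeOfDegree⇒sum zero [] _ = refl
isSquarefreeOfDegree⇒sum s (0 ∷ β) h = isSquarefreeOfDegree⇒sum s β h
isSquarefreeOfDegree⇒sum (suc s) (1 ∷ β) h = cong suc (isSquarefreeOfDegree⇒sum s β h)
isSquarefreeOfDegree⇒sum zero (1 ∷ β) ()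
isSquarefreeOfDegree⇒sum s (suc (suc _) ∷ β) ()

isSquarefreeOfDegree⇒≤1 : ∀ s (β : Mono n) → isSquarefreeOfDegree s β ≡ true → ∀ i → lookup β i ≤ 1
isSquarefreeOfDegree⇒≤1 s (0 ∷ β) h zero = z≤n
isSquarefreeOfDegree⇒≤1 s (0 ∷ β) h (suc i) = isSquarefreeOfDegree⇒≤1 s β h i
isSquarefreeOfDegree⇒≤1 (suc s) (1 ∷ β) h zero = s≤s z≤n
isSquarefreeOfDegree⇒≤1 (suc s) (1 ∷ β) h (suc i) = isSquarefreeOfDegree⇒≤1 s β h i
isSquarefreeOfDegree⇒≤1 s (suc (suc _) ∷ β) () i

≤1⇒isSquarefreeOfDegree : (β : Mono n) → (∀ i → lookup β i ≤ 1) → isSquarefreeOfDegree (Vec.sum β) β ≡ true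
≤1⇒isSquarefreeOfDegree [] _ = refl
≤1⇒isSquarefreeOfDegree (0 ∷ β) h = ≤1⇒isSquarefreeOfDegree β (h ∘ suc)
≤1⇒isSquarefreeOfDegree (1 ∷ β) h = ≤1⇒isSquarefreeOfDegree β (h ∘ suc)
≤1⇒isSquarefreeOfDegree (suc (suc _) ∷ β) h with h zero
... | s≤s ()

sum-permMono : (σ : Permutation′ n) (β : Mono n) → Vec.sum (permMono σ β) ≡ Vec.sum β
sum-permMono σ β = begin
  Vec.sum (permMono σ β)                     ≡⟨ sum-lookup (permMono σ β) ⟩
  Σ.sum (lookup (permMono σ β))              ≡⟨ Σ.sum-cong-≗ (lookup∘tabulate (λ i → lookup β (σ ⟨$⟩ʳ i))) ⟩
  Σ.sum (λ i → lookup β (σ ⟨$⟩ʳ i))          ≡⟨ Σ.sum-permute (lookup β) σ ⟨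
  Σ.sum (lookup β)                           ≡⟨ sum-lookup β ⟨
  Vec.sum β                                  ∎
  where
  open ≡-Reasoning
  sum-lookup : ∀ {n} (v : Vec ℕ n) → Vec.sum v ≡ Σ.sum (lookup v)
  sum-lookup [] = refl
  sum-lookup (x ∷ v) = cong (x +_) (sum-lookup v)

isSquarefreeOfDegree-permMono : ∀ s (σ : Permutation′ n) β →
                                isSquarefreeOfDegree s (permMono σ β) ≡ isSquarefreeOfDegree s β
isSquarefreeOfDegree-permMono s σ β = bool-ext to from
  where
  bool-ext : ∀ {x y : Bool} → (x ≡ true → y ≡ true) → (y ≡ true → x ≡ true) → x ≡ y
  bool-ext {true} f _ = sym (f refl)
  bool-ext {false} {true} _ g = g refl
  bool-ext {false} {false} _ _ = refl
  to : isSquarefreeOfDegree s (permMono σ β) ≡ true → isSquarefreeOfDegree s β ≡ true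
  to h = subst (λ t → isSquarefreeOfDegree t β ≡ true)
               (trans (sym (sum-permMono σ β)) (isSquarefreeOfDegree⇒sum s (permMono σ β) h))
               (≤1⇒isSquarefreeOfDegree β entries≤1)
    where
    entries≤1 : ∀ i → lookup β i ≤ 1
    entries≤1 i = subst (_≤ 1) (trans (lookup∘tabulate (lookup β ∘ (σ ⟨$⟩ʳ_)) (σ ⟨$⟩ˡ i)) (cong (lookup β) (inverseʳ σ)))
                          (isSquarefreeOfDegree⇒≤1 s (permMono σ β) h (σ ⟨$⟩ˡ i))
  from : isSquarefreeOfDegree s β ≡ true → isSquarefreeOfDegree s (permMono σ β) ≡ true
  from h = subst (λ t → isSquarefreeOfDegree t (permMono σ β) ≡ true)
                 (trans (sum-permMono σ β) (isSquarefreeOfDegree⇒sum s β h))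
                 (≤1⇒isSquarefreeOfDegree (permMono σ β) entries≤1)
    where
    entries≤1 : ∀ i → lookup (permMono σ β) i ≤ 1
    entries≤1 i = subst (_≤ 1) (sym (lookup∘tabulate (lookup β ∘ (σ ⟨$⟩ʳ_)) i)) (isSquarefreeOfDegree⇒≤1 s β h (σ ⟨$⟩ʳ i))

cubeSum : (Point n → ℕ) → ℕ
cubeSum {zero} f = f []
cubeSum {suc n} f = cubeSum (f ∘ (true ∷_)) + cubeSum (f ∘ (false ∷_))

cubeSum-cong : {f g : Point n → ℕ} → (∀ y → f y ≡ g y) → cubeSum f ≡ cubeSum g
cubeSum-cong {zero} f≗g = f≗g []
cubeSum-cong {suc n} f≗g = cong₂ _+_ (cubeSum-cong (f≗g ∘ (true ∷_))) (cubeSum-cong (f≗g ∘ (false ∷_)))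

cubeSum-zero : cubeSum {n} (λ _ → 0) ≡ 0
cubeSum-zero {zero} = refl
cubeSum-zero {suc n} = cong₂ _+_ (cubeSum-zero {n}) (cubeSum-zero {n})

cubeSum-+ : (f g : Point n → ℕ) → cubeSum (λ y → f y + g y) ≡ cubeSum f + cubeSum g
cubeSum-+ {zero} f g = refl
cubeSum-+ {suc n} f g = trans (cong₂ _+_ (cubeSum-+ (f ∘ (true ∷_)) (g ∘ (true ∷_))) (cubeSum-+ (f ∘ (false ∷_)) (g ∘ (false ∷_))))
                              (+-interchange (cubeSum (f ∘ (true ∷_))) _ _ _)

cubeSum-* : ∀ c (f : Point n → ℕ) → cubeSum (λ y → c * f y) ≡ c * cubeSum f
cubeSum-* {zero} c f = refl
cubeSum-* {suc n} c f = trans (cong₂ _+_ (cubeSum-* c (f ∘ (true ∷_))) (cubeSum-* c (f ∘ (false ∷_)))) (sym (*-distribˡ-+ c _ _))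

∣-cubeSum : ∀ {d} (f : Point n → ℕ) → (∀ y → d ∣ f y) → d ∣ cubeSum f
∣-cubeSum {zero} f d∣f = d∣f []
∣-cubeSum {suc n} f d∣f = ∣m∣n⇒∣m+n (∣-cubeSum _ (d∣f ∘ (true ∷_))) (∣-cubeSum _ (d∣f ∘ (false ∷_)))

#supersetsOfWeight : Point n → ℕ → ℕ
#supersetsOfWeight [] zero = 1
#supersetsOfWeight [] (suc w) = 0
#supersetsOfWeight (true ∷ S) zero = 0
#supersetsOfWeight (true ∷ S) (suc w) = #supersetsOfWeight S w
#supersetsOfWeight (false ∷ S) zero = #supersetsOfWeight S zero
#supersetsOfWeight (false ∷ S) (suc w) = #supersetsOfWeight S w + #supersetsOfWeight S (suc w)

cubeSum-supersetsOfWeight : (S : Point n) (w : ℕ) →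
  cubeSum (λ y → b2n (weight y ≡ᵇ w) * b2n (S ⊆ᵇ y)) ≡ #supersetsOfWeight S w
cubeSum-supersetsOfWeight [] zero = refl
cubeSum-supersetsOfWeight [] (suc w) = refl
cubeSum-supersetsOfWeight {suc n} (true ∷ S) w = trans (cong₂ _+_ (above w) excluded) (+-identityʳ _)
  where
  excluded : cubeSum {n} (λ y → b2n (weight y ≡ᵇ w) * 0) ≡ 0
  excluded = trans (cubeSum-cong {n} (λ y → *-zeroʳ (b2n (weight y ≡ᵇ w)))) (cubeSum-zero {n})
  above : ∀ w → cubeSum {n} (λ y → b2n (suc (weight y) ≡ᵇ w) * b2n (S ⊆ᵇ y)) ≡ #supersetsOfWeight (true ∷ S) w
  above zero = cubeSum-zero {n}
  above (suc w) = cubeSum-supersetsOfWeight S w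
cubeSum-supersetsOfWeight {suc n} (false ∷ S) zero = cong₂ _+_ (cubeSum-zero {n}) (cubeSum-supersetsOfWeight S zero)
cubeSum-supersetsOfWeight (false ∷ S) (suc w) = cong₂ _+_ (cubeSum-supersetsOfWeight S w) (cubeSum-supersetsOfWeight S (suc w))

#supersetsOfWeight-< : (S : Point n) → ∀ {w} → w < weight S → #supersetsOfWeight S w ≡ 0
#supersetsOfWeight-< (true ∷ S) {zero} _ = refl
#supersetsOfWeight-< (true ∷ S) {suc w} (s≤s w<|S|) = #supersetsOfWeight-< S w<|S|
#supersetsOfWeight-< (false ∷ S) {zero} 0<|S| = #supersetsOfWeight-< S 0<|S|
#supersetsOfWeight-< (false ∷ S) {suc w} w<|S| =
  cong₂ _+_ (#supersetsOfWeight-< S (<-trans (n<1+n w) w<|S|)) (#supersetsOfWeight-< S w<|S|)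

#supersetsOfWeight-+ : (S : Point n) → ∀ t → #supersetsOfWeight S (weight S + t) ≡ coweight S C t
#supersetsOfWeight-+ [] zero = refl
#supersetsOfWeight-+ [] (suc t) = refl
#supersetsOfWeight-+ (true ∷ S) t = #supersetsOfWeight-+ S t
#supersetsOfWeight-+ (false ∷ S) (suc t) = begin
  #supersetsOfWeight (false ∷ S) (weight S + suc t)
    ≡⟨ cong (#supersetsOfWeight (false ∷ S)) (+-suc (weight S) t) ⟩
  #supersetsOfWeight S (weight S + t) + #supersetsOfWeight S (suc (weight S + t))
    ≡⟨ cong (λ v → #supersetsOfWeight S (weight S + t) + #supersetsOfWeight S v) (sym (+-suc (weight S) t)) ⟩
  #supersetsOfWeight S (weight S + t) + #supersetsOfWeight S (weight S + suc t)
    ≡⟨ cong₂ _+_ (#supersetsOfWeight-+ S t) (#supersetsOfWeight-+ S (suc t)) ⟩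
  (coweight S C t) + (coweight S C suc t)
    ≡⟨ nCk+nC[k+1]≡[n+1]C[k+1] (coweight S) t ⟩
  suc (coweight S) C suc t ∎
  where open ≡-Reasoning
#supersetsOfWeight-+ (false ∷ S) zero = trans (cong (#supersetsOfWeight (false ∷ S)) (+-identityʳ (weight S))) (atWeight refl)
  where
  exact : #supersetsOfWeight S (weight S) ≡ 1
  exact = trans (cong (#supersetsOfWeight S) (sym (+-identityʳ (weight S)))) (#supersetsOfWeight-+ S zero)
  atWeight : ∀ {w} → weight S ≡ w → #supersetsOfWeight (false ∷ S) w ≡ 1
  atWeight {zero} |S|≡0 = trans (cong (#supersetsOfWeight S) (sym |S|≡0)) exact
  atWeight {suc w} |S|≡1+w = cong₂ _+_ (#supersetsOfWeight-< S (subst (w <_) (sym |S|≡1+w) (n<1+n w)))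
                                       (trans (cong (#supersetsOfWeight S) (sym |S|≡1+w)) exact)

binomial-#supersetsOfWeight : (S : Point n) (w : ℕ) → (n C w) * (w C weight S) ≡ (n C weight S) * #supersetsOfWeight S w
binomial-#supersetsOfWeight {n} S w with weight S ≤? w
... | no |S|≰w = begin
  (n C w) * (w C weight S)                  ≡⟨ cong ((n C w) *_) (k>n⇒nCk≡0 w<|S|) ⟩
  (n C w) * 0                               ≡⟨ *-zeroʳ (n C w) ⟩
  0                                         ≡⟨ *-zeroʳ (n C weight S) ⟨
  (n C weight S) * 0                        ≡⟨ cong ((n C weight S) *_) (#supersetsOfWeight-< S w<|S|) ⟨
  (n C weight S) * #supersetsOfWeight S w   ∎
  where
  open ≡-Reasoning
  w<|S| : w < weight S
  w<|S| = ≰⇒> |S|≰w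
... | yes |S|≤w = subst₂ (λ m v → (m C v) * (v C weight S) ≡ (m C weight S) * #supersetsOfWeight S v)
                         (weight+coweight S) (m+[n∸m]≡n |S|≤w)
                         (trans (binomial-subsetOfSubset (weight S) (coweight S) t)
                                (cong (((weight S + coweight S) C weight S) *_) (sym (#supersetsOfWeight-+ S t))))
  where
  t : ℕ
  t = w ∸ weight S

-- Symmetrization

supportSize : Mono n → ℕ
supportSize α = weight (support α)

symmetrize : (ℕ → ℕ) → Poly n → Poly n
symmetrize m [] = []
symmetrize {n} m ((c , α) ∷ P) = scale (c * m (supportSize α)) (elementary n (supportSize α)) ++ symmetrize m P

sumOfWeight : (Point n → ℕ) → ℕ → ℕ
sumOfWeight f w = cubeSum (λ y → b2n (weight y ≡ᵇ w) * f y)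

module _ (m : ℕ → ℕ) where

  eval-symmetrize-∷ : ∀ c α (P : Poly n) x → eval (symmetrize m ((c , α) ∷ P)) x ≡
                      c * m (supportSize α) * (weight x C supportSize α) + eval (symmetrize m P) x
  eval-symmetrize-∷ {n} c α P x = begin
    eval (scale k (elementary n s) ++ symmetrize m P) x           ≡⟨ eval-++ (scale k (elementary n s)) _ x ⟩
    eval (scale k (elementary n s)) x + eval (symmetrize m P) x   ≡⟨ cong (_+ _) (eval-scale k (elementary n s) x) ⟩
    k * eval (elementary n s) x + eval (symmetrize m P) x         ≡⟨ cong (λ e → k * e + _) (eval-elementary n s x) ⟩
    k * (weight x C s) + eval (symmetrize m P) x                  ∎
    where
    open ≡-Reasoning
    s k : ℕ
    s = supportSize α
    k = c * m s

  degAtMost-symmetrize : ∀ {d} (P : Poly n) → DegAtMost d P → DegAtMost d (symmetrize m P)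
  degAtMost-symmetrize [] [] = []
  degAtMost-symmetrize {n} ((c , α) ∷ P) (degα≤d ∷ degP≤d) =
    ++⁺ (map⁺ (degAtMost-elementary n _ (≤-trans (weight-support≤monoDeg α) degα≤d))) (degAtMost-symmetrize P degP≤d)

  coeff-symmetrize-permMono : (P : Poly n) (σ : Permutation′ n) (β : Mono n) → coeff (symmetrize m P) (permMono σ β) ≡ coeff (symmetrize m P) β
  coeff-symmetrize-permMono [] σ β = refl
  coeff-symmetrize-permMono {n} ((c , α) ∷ P) σ β = begin
    coeff (scale k (elementary n s) ++ symmetrize m P) (permMono σ β)  ≡⟨ coeff-scale-elementary++ (permMono σ β) ⟩
    k * b2n (isSquarefreeOfDegree s (permMono σ β)) + coeff (symmetrize m P) (permMono σ β)
      ≡⟨ cong₂ (λ b r → k * b2n b + r) (isSquarefreeOfDegree-permMono s σ β) (coeff-symmetrize-permMono P σ β) ⟩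
    k * b2n (isSquarefreeOfDegree s β) + coeff (symmetrize m P) β       ≡⟨ coeff-scale-elementary++ β ⟨
    coeff (scale k (elementary n s) ++ symmetrize m P) β              ∎
    where
    open ≡-Reasoning
    s k : ℕ
    s = supportSize α
    k = c * m s
    coeff-scale-elementary++ : ∀ β → coeff (scale k (elementary n s) ++ symmetrize m P) β ≡
                                     k * b2n (isSquarefreeOfDegree s β) + coeff (symmetrize m P) β
    coeff-scale-elementary++ β = trans (coeff-++ (scale k (elementary n s)) _ β)
      (cong (_+ _) (trans (coeff-scale k (elementary n s) β) (cong (k *_) (coeff-elementary n s β))))

  symmetric-symmetrize : ∀ p (P : Poly n) → Symmetric p (symmetrize m P)
  symmetric-symmetrize p P σ β = ≡⇒≡[mod] (coeff-symmetrize-permMono P σ β)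
    where
    ≡⇒≡[mod] : ∀ {a b} → a ≡ b → a ≡ b [mod p ]
    ≡⇒≡[mod] {a} refl = p∣a∸a , p∣a∸a
      where
      p∣a∸a : p ∣ a ∸ a
      p∣a∸a = subst (p ∣_) (sym (n∸n≡0 a)) (p ∣0)

sumOfWeight-eval-∷ : ∀ c α (P : Poly n) w →
  sumOfWeight (eval ((c , α) ∷ P)) w ≡ c * #supersetsOfWeight (support α) w + sumOfWeight (eval P) w
sumOfWeight-eval-∷ c α P w = begin
  cubeSum (λ y → χ y * (c * evalMono α y + eval P y))
    ≡⟨ cubeSum-cong (λ y → distrib (χ y) c (evalMono α y) (eval P y)) ⟩
  cubeSum (λ y → c * (χ y * evalMono α y) + χ y * eval P y)
    ≡⟨ cubeSum-+ (λ y → c * (χ y * evalMono α y)) (λ y → χ y * eval P y) ⟩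
  cubeSum (λ y → c * (χ y * evalMono α y)) + sumOfWeight (eval P) w
    ≡⟨ cong (_+ sumOfWeight (eval P) w) (cubeSum-* c (λ y → χ y * evalMono α y)) ⟩
  c * cubeSum (λ y → χ y * evalMono α y) + sumOfWeight (eval P) w
    ≡⟨ cong (λ t → c * t + _) (cubeSum-cong (λ y → cong (χ y *_) (evalMono-support α y))) ⟩
  c * cubeSum (λ y → χ y * b2n (support α ⊆ᵇ y)) + sumOfWeight (eval P) w
    ≡⟨ cong (λ t → c * t + _) (cubeSum-supersetsOfWeight (support α) w) ⟩
  c * #supersetsOfWeight (support α) w + sumOfWeight (eval P) w ∎
  where
  open ≡-Reasoning
  χ : Point _ → ℕ
  χ y = b2n (weight y ≡ᵇ w)
  distrib : ∀ i c e r → i * (c * e + r) ≡ c * (i * e) + i * r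
  distrib = solve-∀

module _ {n} {m : ℕ → ℕ} {D : ℕ} (m*C≡D : ∀ {s} → s ≤ n → m s * (n C s) ≡ D) where

  private
    c*m*C≡c*D : ∀ c α → c * m (supportSize α) * (n C supportSize α) ≡ c * D
    c*m*C≡c*D c α = trans (*-assoc c _ _) (cong (c *_) (m*C≡D (weight≤ (support α))))

  eval-symmetrize-full : (P : Poly n) (y : Point n) → weight y ≡ n → eval (symmetrize m P) y ≡ D * eval P y
  eval-symmetrize-full [] y _ = sym (*-zeroʳ D)
  eval-symmetrize-full ((c , α) ∷ P) y |y|≡n = begin
    eval (symmetrize m ((c , α) ∷ P)) y                 ≡⟨ eval-symmetrize-∷ m c α P y ⟩
    c * m s * (weight y C s) + eval (symmetrize m P) y  ≡⟨ cong₂ (λ w r → c * m s * (w C s) + r) |y|≡n (eval-symmetrize-full P y |y|≡n) ⟩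
    c * m s * (n C s) + D * eval P y                    ≡⟨ cong (_+ D * eval P y) (c*m*C≡c*D c α) ⟩
    c * D + D * eval P y                                ≡⟨ distrib c D (eval P y) ⟩
    D * (c * 1 + eval P y)                              ≡⟨ cong (λ e → D * (c * e + eval P y)) (evalMono-full α y |y|≡n) ⟨
    D * (c * evalMono α y + eval P y)                   ∎
    where
    open ≡-Reasoning
    s : ℕ
    s = supportSize α
    distrib : ∀ c D e → c * D + D * e ≡ D * (c * 1 + e)
    distrib = solve-∀

  binomial*eval-symmetrize : (P : Poly n) (x : Point n) →
    (n C weight x) * eval (symmetrize m P) x ≡ D * sumOfWeight (eval P) (weight x)
  binomial*eval-symmetrize [] x = begin
    (n C weight x) * 0                                        ≡⟨ *-zeroʳ (n C weight x) ⟩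
    0                                                         ≡⟨ *-zeroʳ D ⟨
    D * 0                                                     ≡⟨ cong (D *_) (cubeSum-zero {n}) ⟨
    D * cubeSum {n} (λ _ → 0)                                 ≡⟨ cong (D *_) (cubeSum-cong {n} (λ y → *-zeroʳ (b2n (weight y ≡ᵇ weight x)))) ⟨
    D * sumOfWeight {n} (eval []) (weight x)                  ∎
    where open ≡-Reasoning
  binomial*eval-symmetrize ((c , α) ∷ P) x = begin
    (n C w) * eval (symmetrize m ((c , α) ∷ P)) x
      ≡⟨ cong ((n C w) *_) (eval-symmetrize-∷ m c α P x) ⟩
    (n C w) * (c * m s * (w C s) + eval (symmetrize m P) x)
      ≡⟨ distrib (n C w) (c * m s) (w C s) _ ⟩
    c * m s * ((n C w) * (w C s)) + (n C w) * eval (symmetrize m P) x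
      ≡⟨ cong₂ (λ t r → c * m s * t + r) (binomial-#supersetsOfWeight (support α) w) (binomial*eval-symmetrize P x) ⟩
    c * m s * ((n C s) * #supersetsOfWeight (support α) w) + D * sumOfWeight (eval P) w
      ≡⟨ cong (_+ D * sumOfWeight (eval P) w) (trans (sym (*-assoc (c * m s) (n C s) _)) (cong (_* #supersetsOfWeight (support α) w) (c*m*C≡c*D c α))) ⟩
    c * D * #supersetsOfWeight (support α) w + D * sumOfWeight (eval P) w
      ≡⟨ distrib′ c D (#supersetsOfWeight (support α) w) _ ⟩
    D * (c * #supersetsOfWeight (support α) w + sumOfWeight (eval P) w)
      ≡⟨ cong (D *_) (sumOfWeight-eval-∷ c α P w) ⟨
    D * sumOfWeight (eval ((c , α) ∷ P)) w ∎
    where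
    open ≡-Reasoning
    s w : ℕ
    s = supportSize α
    w = weight x
    distrib : ∀ b k e r → b * (k * e + r) ≡ k * (b * e) + b * r
    distrib = solve-∀
    distrib′ : ∀ c D t r → c * D * t + D * r ≡ D * (c * t + r)
    distrib′ = solve-∀

module _ {p : ℕ} (p-prime : Prime p) {n : ℕ} (p∤C : ∀ {w} → w ≤ n → ¬ p ∣ n C w) where

  n∈Zcl⇔n∈Symcl : ∀ d (E : Subset (suc n)) → InZcl p n d E n ⇔ InSymcl p n d E n
  n∈Zcl⇔n∈Symcl d E with ∤-commonMultiple p-prime (n C_) (suc n) (p∤C ∘ s≤s⁻¹)
  ... | D , m , p∤D , m*C≡D = mk⇔ (λ inZcl y |y|≡n P _ → inZcl y |y|≡n P) fromSymcl
    where
    vanishesOn-symmetrize : ∀ P → VanishesOn p E P → VanishesOn p E (symmetrize m P)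
    vanishesOn-symmetrize P P|E x x∈E = ∤-∣*⇒∣ p-prime (p∤C (weight≤ x))
      (subst (p ∣_) (sym (binomial*eval-symmetrize (m*C≡D ∘ s≤s) P x)) (∣-trans (∣-cubeSum _ p∣term) (n∣m*n D)))
      where
      p∣term : ∀ y → p ∣ b2n (weight y ≡ᵇ weight x) * eval P y
      p∣term y with weight y ≡ᵇ weight x in eq
      ... | true = ∣-trans (P|E y (subst (InE E) (sym (≡ᵇ⇒≡ _ _ (subst T (sym eq) tt))) x∈E)) (n∣m*n 1)
      ... | false = p ∣0
    fromSymcl : InSymcl p n d E n → InZcl p n d E n
    fromSymcl inSymcl y |y|≡n P deg P|E = ∤-∣*⇒∣ p-prime p∤D
      (subst (p ∣_) (eval-symmetrize-full (m*C≡D ∘ s≤s) P y |y|≡n)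
        (inSymcl y |y|≡n (symmetrize m P) (symmetric-symmetrize m p P) (degAtMost-symmetrize m P deg) (vanishesOn-symmetrize P P|E)))

lemma4p13 : (p : ℕ) → Prime p → (r k : ℕ) → 1 ≤ k → k ≤ p ∸ 1 →
    (d : ℕ) → d ≤ (k + 1) * p ^ r ∸ 1 →
    (E : Subset (suc ((k + 1) * p ^ r ∸ 1))) →
    InZcl p ((k + 1) * p ^ r ∸ 1) d E ((k + 1) * p ^ r ∸ 1)
      ⇔ InSymcl p ((k + 1) * p ^ r ∸ 1) d E ((k + 1) * p ^ r ∸ 1)
lemma4p13 p p-prime r k _ k≤p∸1 d _ E = n∈Zcl⇔n∈Symcl p-prime p∤binomial d E
  where
  N : ℕ
  N = (k + 1) * p ^ r
  instance
    p-nonZero : NonZero p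
    p-nonZero = nonTrivial⇒nonZero p {{prime⇒nonTrivial p-prime}}
    N-nonZero : NonZero N
    N-nonZero = m*n≢0 (k + 1) (p ^ r) {{>-nonZero (m≤n+m 1 k)}} {{m^n≢0 p r}}
  suc[N∸1]≡N : suc (N ∸ 1) ≡ N
  suc[N∸1]≡N = suc-pred N
  k+1≤p : k + 1 ≤ p
  k+1≤p = subst (k + 1 ≤_) (m∸n+n≡m (>-nonZero⁻¹ p)) (+-monoˡ-≤ 1 k≤p∸1)
  p∤binomial : ∀ {w} → w ≤ N ∸ 1 → ¬ p ∣ (N ∸ 1) C w
  p∤binomial = prime∤binomial p-prime {r}
    (subst (p ^ r ∣_) (sym suc[N∸1]≡N) (n∣m*n (k + 1)))
    (subst (_≤ p ^ suc r) (sym suc[N∸1]≡N) (*-monoˡ-≤ (p ^ r) k+1≤p))
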